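{- Let $F_{2,2}=F_2\otimes F_2=\begin{pmatrix}1&1&1&1\\1&-1&1&-1\\1&1&-1&-1\\1&-1&-1&1\end{pmatrix}$, regarded as a matrix with entries in $\mathbb Z_2=\{\pm1\}$. Its associated measure is $$\mu=\frac{1}{32}\left(\delta_4+12\delta_6+6\delta_8+12\delta_{10}+\delta_{12}\right).$$
   Context: For an $N\times N$ complex Hadamard matrix $H$ with entries in the group $\mathbb Z_s$ of $s$-th roots of unity, define $\varphi:\mathbb Z_s^N\times\mathbb Z_s^N\to\mathbb N$ by $\varphi(a,b)=\#\{(i,j)\mid a_ib_jH_{ij}=1\}$, and let $\mu$ be the distribution of $\varphi$ under the uniform probability on $\mathbb Z_s^N\times\mathbb Z_s^N$, i.e. $\mu(\{k\})=s^{ -2N}\#\{(a,b)\mid\varphi(a,b)=k\}$. Here $N=4$, $s=2$; $\delta_k$ is the Dirac mass at $k$. -}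

module Defs where

open import Data.Nat using (ℕ; zero; suc; _^_; _≟_)
open import Data.Fin using (Fin; zero; suc)
open import Data.Sign using (Sign) renaming (_*_ to _·_)
open import Data.List using (List; []; _∷_; map; concatMap; length; filter; allFin; cartesianProduct)
open import Data.Nat.Properties using (m^n≢0)
open import Data.Product using (_×_; _,_)
open import Data.Integer using (+_)
open import Data.Rational using (ℚ; _/_; 0ℚ; 1ℚ)
open import Relation.Binary.PropositionalEquality using (_≡_)
open import Relation.Nullary using (yes; no)

-- The group Z_2 = {±1} of square roots of unity is Data.Sign.Sign
-- (Sign.+ = 1, Sign.- = -1, multiplication Data.Sign._*_).

allVecs : (N : ℕ) → List (Fin N → Sign)
allVecs zero = (λ ()) ∷ []
allVecs (suc N) = concatMap (λ v → (λ { zero → Sign.+ ; (suc i) → v i }) ∷ (λ { zero → Sign.- ; (suc i) → v i }) ∷ []) (allVecs N)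

φ : {N : ℕ} → (Fin N → Fin N → Sign) → (Fin N → Sign) → (Fin N → Sign) → ℕ
φ {N} H a b = length (filter (λ { (i , j) → Data.Sign._≟_ ((a i · b j) · H i j) Sign.+ })
                             (cartesianProduct (allFin N) (allFin N)))

count : {N : ℕ} → (Fin N → Fin N → Sign) → ℕ → ℕ
count {N} H k = length (filter (λ { (a , b) → φ H a b ≟ k })
                               (cartesianProduct (allVecs N) (allVecs N)))

-- μ({k}) = s^{-2N} #{(a,b) | φ(a,b) = k}, with s = 2
μ : {N : ℕ} → (Fin N → Fin N → Sign) → ℕ → ℚ
μ {N} H k = _/_ (+ count H k) (2 ^ (N Data.Nat.+ N)) {{m^n≢0 2 (N Data.Nat.+ N)}}

-- Dirac mass at m, evaluated on the singleton {k}
δ : ℕ → ℕ → ℚ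
δ m k with m ≟ k
... | yes _ = 1ℚ
... | no _ = 0ℚ

F22 : Fin 4 → Fin 4 → Sign
F22 i j = row i j
  where
  p m : Sign
  p = Sign.+
  m = Sign.-
  row : Fin 4 → Fin 4 → Sign
  row zero = λ { zero → p ; (suc zero) → p ; (suc (suc zero)) → p ; (suc (suc (suc zero))) → p }
  row (suc zero) = λ { zero → p ; (suc zero) → m ; (suc (suc zero)) → p ; (suc (suc (suc zero))) → m }
  row (suc (suc zero)) = λ { zero → p ; (suc zero) → p ; (suc (suc zero)) → m ; (suc (suc (suc zero))) → m }
  row (suc (suc (suc zero))) = λ { zero → p ; (suc zero) → m ; (suc (suc zero)) → m ; (suc (suc (suc zero))) → p }

module Submission where

-- For a general N × N matrix H, every value φ H a b counts a subset of the
-- N² index pairs (i , j), so φ H a b ≤ N²; hence no pair (a , b) attains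
-- a value k > N², the count vanishes and μ H k = 0.  The file proves this
-- support bound first:
--   * length-cartesianProduct, length-allFin : sizes of the enumerations;
--   * φ-bounded   : φ H a b ≤ N²;
--   * count-beyond-support : count H k ≡ 0 whenever N² < k.
-- For F_{2,2} (N = 4) the theorem then splits into the seventeen values
-- k = 0, …, 16, each a closed computation over the 2⁴ · 2⁴ = 256 sign pairs
-- (checked by evaluation), and the tail k > 16, where both sides are zero:
-- the left by count-beyond-support, the right because every Dirac mass
-- δ 4, …, δ 12 vanishes there.

open import Defs
open import Data.Nat using (ℕ; suc; _≤_; _<_; _≟_; s≤s) renaming (_*_ to _*ℕ_; _+_ to _+ℕ_)
open import Data.Nat.Properties using (<⇒≢; <-≤-trans; m≤m+n)
open import Data.Empty using (⊥)
open import Data.Fin using (Fin)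
open import Data.Sign using (Sign)
open import Data.Integer using (+_)
open import Data.Rational using (_/_; _*_; _+_)
open import Data.List using (List; []; _∷_; _++_; length; map; filter; allFin; cartesianProduct)
open import Data.List.Properties using (length-++; length-map; length-tabulate; length-filter; filter-none)
open import Data.List.Relation.Unary.All using (universal)
open import Data.Product using (_×_; _,_; proj₁; proj₂)
open import Relation.Binary.PropositionalEquality using (_≡_; refl; trans; cong; cong₂; subst; module ≡-Reasoning)

length-cartesianProduct : ∀ {A B : Set} (xs : List A) (ys : List B) →
  length (cartesianProduct xs ys) ≡ length xs *ℕ length ys
length-cartesianProduct [] ys = refl
length-cartesianProduct (x ∷ xs) ys = begin
  length (map (x ,_) ys ++ cartesianProduct xs ys)
    ≡⟨ length-++ (map (x ,_) ys) ⟩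
  length (map (x ,_) ys) +ℕ length (cartesianProduct xs ys)
    ≡⟨ cong₂ _+ℕ_ (length-map (x ,_) ys) (length-cartesianProduct xs ys) ⟩
  length ys +ℕ length xs *ℕ length ys
    ∎
  where open ≡-Reasoning

length-allFin : ∀ N → length (allFin N) ≡ N
length-allFin N = length-tabulate (λ (i : Fin N) → i)

-- φ counts a subset of the N² index pairs, so it never exceeds N².
φ-bounded : ∀ {N} (H : Fin N → Fin N → Sign) a b → φ H a b ≤ N *ℕ N
φ-bounded {N} H a b = subst (φ H a b ≤_) pairs-count (length-filter _ pairs)
  where
  pairs : List (Fin N × Fin N)
  pairs = cartesianProduct (allFin N) (allFin N)

  pairs-count : length pairs ≡ N *ℕ N
  pairs-count = trans (length-cartesianProduct (allFin N) (allFin N))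
                      (cong₂ _*ℕ_ (length-allFin N) (length-allFin N))

count-beyond-support : ∀ {N} (H : Fin N → Fin N → Sign) k → N *ℕ N < k → count H k ≡ 0
count-beyond-support {N} H k N²<k =
  cong length (filter-none (λ p → φ H (proj₁ p) (proj₂ p) ≟ k)
                           (universal (λ p → φ≢k (proj₁ p) (proj₂ p)) pairs))
  where
  pairs : List ((Fin N → Sign) × (Fin N → Sign))
  pairs = cartesianProduct (allVecs N) (allVecs N)

  φ≢k : ∀ a b → φ H a b ≡ k → ⊥
  φ≢k a b = <⇒≢ (<-≤-trans (s≤s (φ-bounded H a b)) N²<k)

proposition4p9 : ∀ (k : ℕ) →
    μ F22 k ≡ (+ 1 / 32) * (δ 4 k + (+ 12 / 1) * δ 6 k + (+ 6 / 1) * δ 8 k + (+ 12 / 1) * δ 10 k + δ 12 k)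
-- Inside the support 0 ≤ k ≤ 16: direct evaluation of the 256 sign pairs.
proposition4p9 0 = refl
proposition4p9 1 = refl
proposition4p9 2 = refl
proposition4p9 3 = refl
proposition4p9 4 = refl
proposition4p9 5 = refl
proposition4p9 6 = refl
proposition4p9 7 = refl
proposition4p9 8 = refl
proposition4p9 9 = refl
proposition4p9 10 = refl
proposition4p9 11 = refl
proposition4p9 12 = refl
proposition4p9 13 = refl
proposition4p9 14 = refl
proposition4p9 15 = refl
proposition4p9 16 = refl
-- Outside the support k = 17 + n: the count is zero, and so is every δ.
proposition4p9 k@(suc (suc (suc (suc (suc (suc (suc (suc (suc (suc (suc (suc (suc (suc (suc (suc (suc n)))))))))))))))))
  rewrite count-beyond-support F22 k (s≤s (m≤m+n 16 n)) = refl
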